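{- For every simple graph $G$, all vertices $x,y\in V(G)$, and every $k\ge 0$, $m_k(G_{x\to y})\le m_k(G)$.
   Context: For a graph $G$ and vertices $x,y$, let $N_G(x,\overline{y})=\{v\in V(G)\setminus\{x,y\}: v\sim x,\ v\not\sim y\}$. The compression $G_{x\to y}$ is the graph obtained from $G$ by deleting all edges between $x$ and $N_G(x,\overline{y})$ and adding all edges from $y$ to $N_G(x,\overline{y})$. A matching is a set of pairwise non-incident edges; $m_k(G)$ is the number of matchings of $G$ with exactly $k$ edges. -}

module Defs where

open import Data.Nat using (ℕ; _≡ᵇ_)
open import Data.Bool using (Bool; true; false; _∧_; _∨_; not; if_then_else_)
open import Data.Fin using (Fin; _≟_; _<?_)
open import Data.List using (List; []; _∷_; length; filter; concatMap; map; allFin; _++_)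
open import Data.Product using (_×_; _,_)
open import Relation.Nullary.Decidable using (⌊_⌋)
open import Relation.Binary.PropositionalEquality using (_≡_)

record SimpleGraph (n : ℕ) : Set where
  field
    adj    : Fin n → Fin n → Bool
    sym    : ∀ u v → adj u v ≡ adj v u
    irrefl : ∀ v → adj v v ≡ false
open SimpleGraph public

Adj : ℕ → Set
Adj n = Fin n → Fin n → Bool

_==_ : ∀ {n} → Fin n → Fin n → Bool
u == v = ⌊ u ≟ v ⌋

inN : ∀ {n} → Adj n → Fin n → Fin n → Fin n → Bool
inN a x y v = not (v == x) ∧ not (v == y) ∧ a v x ∧ not (a v y)

-- adjacency of the compression G_{x→y}: delete edges x–w and add edges y–w
-- for all w ∈ N_G(x, ȳ); all other adjacencies unchanged.
compressAdj : ∀ {n} → Adj n → Fin n → Fin n → Adj n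
compressAdj a x y u v =
  if (inN a x y u ∧ (v == x)) ∨ (inN a x y v ∧ (u == x)) then false
  else if (inN a x y u ∧ (v == y)) ∨ (inN a x y v ∧ (u == y)) then true
  else a u v

-- all unordered pairs {i,j} of distinct vertices, represented as (i , j) with i < j
allPairs : (n : ℕ) → List (Fin n × Fin n)
allPairs n = concatMap (λ i → map (λ j → (i , j)) (filter (λ j → i <? j) (allFin n))) (allFin n)

subsets : ∀ {A : Set} → List A → List (List A)
subsets [] = [] ∷ []
subsets (x ∷ xs) = let s = subsets xs in s ++ map (x ∷_) s

disjointPair : ∀ {n} → Fin n × Fin n → Fin n × Fin n → Bool
disjointPair (a , b) (c , d) = not (a == c) ∧ not (a == d) ∧ not (b == c) ∧ not (b == d)

allB : ∀ {A : Set} → (A → Bool) → List A → Bool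
allB p [] = true
allB p (x ∷ xs) = p x ∧ allB p xs

isMatching : ∀ {n} → Adj n → List (Fin n × Fin n) → Bool
isMatching a [] = true
isMatching a ((u , v) ∷ es) = a u v ∧ allB (disjointPair (u , v)) es ∧ isMatching a es

matchCount : ∀ {n} → ℕ → Adj n → ℕ
matchCount {n} k a =
  length (filter (λ S → isMatching a S ∧ (length S ≡ᵇ k) Data.Bool.≟ true) (subsets (allPairs n)))

m : ∀ {n} → ℕ → SimpleGraph n → ℕ
m k G = matchCount k (adj G)

mCompress : ∀ {n} → ℕ → SimpleGraph n → Fin n → Fin n → ℕ
mCompress k G x y = matchCount k (compressAdj (adj G) x y)

module Submission where

-- Write a for the adjacency of G, a′ for that of the
-- compression G′ = G_{x→y}, N for N_G(x, ȳ) and σ for the transposition (x y).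
-- We inject the k-matchings of G′ into those of G:
--   * a matching of G′ using only edges of G is sent to itself;
--   * otherwise it contains a new edge {w , y} (w ∈ N) and is sent to its image under σ.
-- In the second case σ(M) is a matching of G: {w , y} becomes {w , x} ∈ E(G), an edge
-- {x , z} of M becomes {y , z} ∈ E(G) (z ∉ N), and edges avoiding x, y are unchanged.
-- But σ(M) is not a matching of G′, since G′ lacks {w , x}; so the two cases have
-- disjoint images, and each case is injective (σ is an involution).

open import Data.Nat using (ℕ; _≤_; _≡ᵇ_)
open import Data.Nat.Properties using (≤-antisym)
open import Data.Bool using (Bool; true; false; _∧_; _∨_; not; if_then_else_)
import Data.Bool
open import Data.Bool.Properties using (∧-zeroʳ; ∨-comm; ∨-zeroʳ; ∨-identityʳ)
open import Data.Fin using (Fin; zero; suc; _<_; _≟_; _<?_)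
open import Data.Fin.Properties using (injective⇒≤; <⇒≢; <-asym; <-cmp)
open import Data.List using (List; []; _∷_; length; filter; map; lookup; allFin)
open import Data.List.Properties using (∷-injectiveʳ)
open import Data.List.Membership.Propositional using (_∈_)
open import Data.List.Membership.Propositional.Properties
open import Data.List.Relation.Unary.Any using (here; there; index)
open import Data.List.Relation.Unary.Any.Properties using (lookup-index)
open import Data.List.Relation.Unary.All as All using (All; []; _∷_)
open import Data.List.Relation.Unary.AllPairs as AllPairs using ([]; _∷_)
import Data.List.Relation.Unary.AllPairs.Properties as AllPairsₚ
open import Data.List.Relation.Unary.Unique.Propositional using (Unique)
open import Data.List.Relation.Unary.Unique.Propositional.Properties
  using (++⁺; map⁺; concat⁺; filter⁺; allFin⁺)
open import Data.List.Relation.Binary.Disjoint.Propositional using (Disjoint)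
open import Data.Product using (_×_; _,_; Σ; proj₁; proj₂)
open import Data.Product.Properties using (≡-dec)
open import Data.Sum using (_⊎_; inj₁; inj₂)
open import Data.Empty using (⊥; ⊥-elim)
open import Relation.Nullary using (yes; no)
open import Relation.Nullary.Decidable using (toSum)
open import Relation.Unary using (Decidable)
open import Relation.Binary using (tri<; tri≈; tri>)
open import Relation.Binary.PropositionalEquality
  using (_≡_; _≢_; refl; sym; trans; cong; cong₂; subst)
open import Defs renaming (sym to adj-sym)

-- Counting by injection, and the sub-collections enumerated by subsets.
module _ {A : Set} where

  lookup-injective : ∀ {xs : List A} → Unique xs → ∀ {i j} → lookup xs i ≡ lookup xs j → i ≡ j
  lookup-injective {_ ∷ _} _ {zero} {zero} _ = refl
  lookup-injective {_ ∷ _} (x∉ ∷ _) {zero} {suc j} e = ⊥-elim (All.lookup x∉ (∈-lookup j) e)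
  lookup-injective {_ ∷ _} (x∉ ∷ _) {suc i} {zero} e = ⊥-elim (All.lookup x∉ (∈-lookup i) (sym e))
  lookup-injective {_ ∷ _} (_ ∷ u) {suc i} {suc j} e = cong suc (lookup-injective u e)

  length-≤-by-injection : ∀ {B : Set} (xs : List A) (ys : List B) (f : A → B) → Unique xs →
    (∀ {a} → a ∈ xs → f a ∈ ys) →
    (∀ {a b} → a ∈ xs → b ∈ xs → f a ≡ f b → a ≡ b) → length xs ≤ length ys
  length-≤-by-injection xs ys f uxs into inj = injective⇒≤ {f = position} position-injective
    where
    position : Fin (length xs) → Fin (length ys)
    position i = index (into (∈-lookup i))
    position-injective : ∀ {i j} → position i ≡ position j → i ≡ j
    position-injective {i} {j} e = lookup-injective uxs (inj (∈-lookup i) (∈-lookup j)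
      (trans (lookup-index (into (∈-lookup i)))
        (trans (cong (lookup ys) e) (sym (lookup-index (into (∈-lookup j)))))))

  subsets-∷⁻ : ∀ {x : A} {xs S} → S ∈ subsets (x ∷ xs) →
    S ∈ subsets xs ⊎ Σ (List A) (λ T → T ∈ subsets xs × S ≡ x ∷ T)
  subsets-∷⁻ {x} {xs} S∈ with ∈-++⁻ (subsets xs) S∈
  ... | inj₁ S∈′ = inj₁ S∈′
  ... | inj₂ S∈′ = inj₂ (map∷⁻ S∈′)

  subsets-⊆ : ∀ (l : List A) {S z} → S ∈ subsets l → z ∈ S → z ∈ l
  subsets-⊆ [] (here refl) ()
  subsets-⊆ (x ∷ xs) S∈ z∈ with subsets-∷⁻ {x} {xs} S∈
  ... | inj₁ S∈′ = there (subsets-⊆ xs S∈′ z∈)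
  ... | inj₂ (T , T∈ , refl) with z∈
  ...   | here e = here e
  ...   | there z∈T = there (subsets-⊆ xs T∈ z∈T)

  subsets-member-unique : ∀ (l : List A) {S} → Unique l → S ∈ subsets l → Unique S
  subsets-member-unique [] _ (here refl) = []
  subsets-member-unique (x ∷ xs) (x∉ ∷ u) S∈ with subsets-∷⁻ {x} {xs} S∈
  ... | inj₁ S∈′ = subsets-member-unique xs u S∈′
  ... | inj₂ (T , T∈ , refl) =
    All.tabulate (λ z∈T → All.lookup x∉ (subsets-⊆ xs T∈ z∈T)) ∷ subsets-member-unique xs u T∈

  subsets-unique : ∀ (l : List A) → Unique l → Unique (subsets l)
  subsets-unique [] _ = [] ∷ []
  subsets-unique (x ∷ xs) (x∉ ∷ u) =
    ++⁺ (subsets-unique xs u) (map⁺ ∷-injectiveʳ (subsets-unique xs u)) omit-vs-keep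
    where
    omit-vs-keep : Disjoint (subsets xs) (map (x ∷_) (subsets xs))
    omit-vs-keep (S∈ , S∈′) with map∷⁻ S∈′
    ... | _ , _ , refl = All.lookup x∉ (subsets-⊆ xs S∈ (here refl)) refl

  subsets-ext : ∀ (l : List A) {S S′} → Unique l → S ∈ subsets l → S′ ∈ subsets l →
    (∀ {z} → z ∈ S → z ∈ S′) → (∀ {z} → z ∈ S′ → z ∈ S) → S ≡ S′
  subsets-ext [] _ (here refl) (here refl) _ _ = refl
  subsets-ext (x ∷ xs) (x∉ ∷ u) S∈ S′∈ ⊆₁ ⊆₂ with subsets-∷⁻ {x} {xs} S∈ | subsets-∷⁻ {x} {xs} S′∈
  ... | inj₁ a | inj₁ b = subsets-ext xs u a b ⊆₁ ⊆₂
  ... | inj₁ a | inj₂ (_ , _ , refl) = ⊥-elim (All.lookup x∉ (subsets-⊆ xs a (⊆₂ (here refl))) refl)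
  ... | inj₂ (_ , _ , refl) | inj₁ b = ⊥-elim (All.lookup x∉ (subsets-⊆ xs b (⊆₁ (here refl))) refl)
  ... | inj₂ (T , T∈ , refl) | inj₂ (T′ , T′∈ , refl) =
    cong (x ∷_) (subsets-ext xs u T∈ T′∈ (drop-x T∈ ⊆₁) (drop-x T′∈ ⊆₂))
    where
    drop-x : ∀ {R R′} → R ∈ subsets xs → (∀ {z} → z ∈ x ∷ R → z ∈ x ∷ R′) → ∀ {z} → z ∈ R → z ∈ R′
    drop-x R∈ ⊆ z∈ with ⊆ (there z∈)
    ... | here refl = ⊥-elim (All.lookup x∉ (subsets-⊆ xs R∈ z∈) refl)
    ... | there z∈′ = z∈′

  filter-∈-subsets : ∀ {P : A → Set} (P? : Decidable P) (l : List A) → filter P? l ∈ subsets l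
  filter-∈-subsets P? [] = here refl
  filter-∈-subsets P? (x ∷ xs) with P? x
  ... | yes _ = ∈-++⁺ʳ (subsets xs) (∈-map⁺ (x ∷_) (filter-∈-subsets P? xs))
  ... | no _ = ∈-++⁺ˡ (filter-∈-subsets P? xs)

∧-true : ∀ a {b} → a ∧ b ≡ true → a ≡ true × b ≡ true
∧-true true {true} _ = refl , refl

∧-intro : ∀ {a b} → a ≡ true → b ≡ true → a ∧ b ≡ true
∧-intro refl refl = refl

∨-true : ∀ a {b} → a ∨ b ≡ true → a ≡ true ⊎ b ≡ true
∨-true true _ = inj₁ refl
∨-true false h = inj₂ h

not-true : ∀ {a} → not a ≡ true → a ≡ false
not-true {false} _ = refl

not-intro : ∀ {a} → a ≡ false → not a ≡ true
not-intro refl = refl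

not-false : ∀ {a} → not a ≡ false → a ≡ true
not-false {true} _ = refl

true≢false : true ≢ false
true≢false ()

module _ {n : ℕ} where

  ==-refl : ∀ (u : Fin n) → (u == u) ≡ true
  ==-refl u with u ≟ u
  ... | yes _ = refl
  ... | no u≢u = ⊥-elim (u≢u refl)

  ==-false : ∀ {u v : Fin n} → u ≢ v → (u == v) ≡ false
  ==-false {u} {v} u≢v with u ≟ v
  ... | yes u≡v = ⊥-elim (u≢v u≡v)
  ... | no _ = refl

  ==-true⇒≡ : ∀ {u v : Fin n} → (u == v) ≡ true → u ≡ v
  ==-true⇒≡ {u} {v} h with u ≟ v
  ... | yes u≡v = u≡v

  not-==⇒≢ : ∀ {u v : Fin n} → not (u == v) ≡ true → u ≢ v
  not-==⇒≢ {u} h refl with trans (sym (==-refl u)) (not-true h)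
  ... | ()

  Pair : Set
  Pair = Fin n × Fin n

  _∈ᵥ_ : Fin n → Pair → Set
  v ∈ᵥ p = v ≡ proj₁ p ⊎ v ≡ proj₂ p

  Apart : Pair → Pair → Set
  Apart p q = ∀ {v} → v ∈ᵥ p → v ∈ᵥ q → ⊥

  disjointPair⇒Apart : ∀ {a b c d : Fin n} → disjointPair (a , b) (c , d) ≡ true → Apart (a , b) (c , d)
  disjointPair⇒Apart {a} {b} {c} {d} h
    with ∧-true (not (a == c)) h
  ... | a≢c , h′ with ∧-true (not (a == d)) h′
  ... | a≢d , h″ with ∧-true (not (b == c)) h″
  ... | b≢c , b≢d = shared
    where
    shared : Apart (a , b) (c , d)
    shared (inj₁ refl) (inj₁ refl) = not-==⇒≢ a≢c refl
    shared (inj₁ refl) (inj₂ refl) = not-==⇒≢ a≢d refl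
    shared (inj₂ refl) (inj₁ refl) = not-==⇒≢ b≢c refl
    shared (inj₂ refl) (inj₂ refl) = not-==⇒≢ b≢d refl

  Apart⇒disjointPair : ∀ {a b c d : Fin n} → Apart (a , b) (c , d) → disjointPair (a , b) (c , d) ≡ true
  Apart⇒disjointPair apart =
    ∧-intro (not-intro (==-false (λ e → apart (inj₁ refl) (inj₁ e))))
    (∧-intro (not-intro (==-false (λ e → apart (inj₁ refl) (inj₂ e))))
    (∧-intro (not-intro (==-false (λ e → apart (inj₂ refl) (inj₁ e))))
             (not-intro (==-false (λ e → apart (inj₂ refl) (inj₂ e))))))

module _ {A : Set} {f : A → Bool} where

  allB-sound : ∀ {xs} → allB f xs ≡ true → ∀ {q} → q ∈ xs → f q ≡ true
  allB-sound {x ∷ _} h (here refl) = proj₁ (∧-true (f x) h)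
  allB-sound {x ∷ _} h (there q∈) = allB-sound (proj₂ (∧-true (f x) h)) q∈

  allB-complete : ∀ {xs} → (∀ {q} → q ∈ xs → f q ≡ true) → allB f xs ≡ true
  allB-complete {[]} _ = refl
  allB-complete {x ∷ xs} h = ∧-intro (h (here refl)) (allB-complete (λ q∈ → h (there q∈)))

  allB-false : ∀ {xs} → allB f xs ≡ false → Σ A (λ q → q ∈ xs × f q ≡ false)
  allB-false {x ∷ xs} h with f x in fx
  ... | false = x , here refl , fx
  ... | true with allB-false {xs} h
  ...   | q , q∈ , fq = q , there q∈ , fq

module _ {n : ℕ} where

  IsEdge : Adj n → Pair → Set
  IsEdge a p = a (proj₁ p) (proj₂ p) ≡ true

  Matching : Adj n → List Pair → Set
  Matching a S = (∀ {p} → p ∈ S → IsEdge a p) × (∀ {p q} → p ∈ S → q ∈ S → p ≢ q → Apart p q)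

  Matching-⊆ : ∀ {a S T} → Matching a S → (∀ {q} → q ∈ T → q ∈ S) → Matching a T
  Matching-⊆ (edges , disjoint) T⊆S = (λ q∈ → edges (T⊆S q∈)) , (λ p∈ q∈ → disjoint (T⊆S p∈) (T⊆S q∈))

  isMatching⇒Matching : ∀ (a : Adj n) S → isMatching a S ≡ true → Matching a S
  isMatching⇒Matching a [] _ = (λ ()) , (λ ())
  isMatching⇒Matching a ((u , v) ∷ es) h
    with ∧-true (a u v) h
  ... | uv , h′ with ∧-true (allB (disjointPair (u , v)) es) h′
  ... | apart , h″ with isMatching⇒Matching a es h″
  ... | edges , disjoint = edges′ , disjoint′
    where
    edges′ : ∀ {p} → p ∈ (u , v) ∷ es → IsEdge a p
    edges′ (here refl) = uv
    edges′ (there p∈) = edges p∈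
    disjoint′ : ∀ {p q} → p ∈ (u , v) ∷ es → q ∈ (u , v) ∷ es → p ≢ q → Apart p q
    disjoint′ (here refl) (here refl) p≢q = ⊥-elim (p≢q refl)
    disjoint′ (here refl) (there q∈) _ = disjointPair⇒Apart (allB-sound apart q∈)
    disjoint′ (there p∈) (here refl) _ = λ w∈p w∈q → disjointPair⇒Apart (allB-sound apart p∈) w∈q w∈p
    disjoint′ (there p∈) (there q∈) = disjoint p∈ q∈

  -- The converse needs the list to be duplicate-free.
  Matching⇒isMatching : ∀ (a : Adj n) S → Unique S → Matching a S → isMatching a S ≡ true
  Matching⇒isMatching a [] _ _ = refl
  Matching⇒isMatching a ((u , v) ∷ es) (uv∉ ∷ u-es) (edges , disjoint) =
    ∧-intro (edges (here refl))
    (∧-intro (allB-complete (λ {q} q∈ →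
                apart-head q (disjoint (here refl) (there q∈) (All.lookup uv∉ q∈))))
             (Matching⇒isMatching a es u-es (Matching-⊆ (edges , disjoint) there)))
    where
    apart-head : ∀ q → Apart (u , v) q → disjointPair (u , v) q ≡ true
    apart-head (_ , _) = Apart⇒disjointPair

  Pairs : List Pair
  Pairs = allPairs n

  private
    row : Fin n → List Pair
    row i = map (λ j → (i , j)) (filter (λ j → i <? j) (allFin n))

  Pairs-ordered : ∀ {p} → p ∈ Pairs → proj₁ p < proj₂ p
  Pairs-ordered p∈ with ∈-concat⁻′ (map row (allFin n)) p∈
  ... | _ , p∈row , row∈ with ∈-map⁻ row row∈
  ... | i , _ , refl with ∈-map⁻ _ p∈row
  ... | j , j∈ , refl = proj₂ (∈-filter⁻ (λ j → i <? j) {xs = allFin n} j∈)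

  Pairs-complete : ∀ {i j : Fin n} → i < j → (i , j) ∈ Pairs
  Pairs-complete {i} {j} i<j =
    ∈-concat⁺′ (∈-map⁺ (λ j → (i , j)) (∈-filter⁺ (λ j → i <? j) (∈-allFin j) i<j))
               (∈-map⁺ row (∈-allFin i))

  Pairs-unique : Unique Pairs
  Pairs-unique =
    concat⁺ (All.tabulate row-unique) (AllPairsₚ.map⁺ (AllPairs.map rows-disjoint (allFin⁺ n)))
    where
    row-unique : ∀ {r} → r ∈ map row (allFin n) → Unique r
    row-unique r∈ with ∈-map⁻ row r∈
    ... | i , _ , refl = map⁺ (cong proj₂) (filter⁺ (λ j → i <? j) (allFin⁺ n))
    rows-disjoint : ∀ {i i′} → i ≢ i′ → Disjoint (row i) (row i′)
    rows-disjoint i≢i′ (p∈ , p∈′) with ∈-map⁻ _ p∈ | ∈-map⁻ _ p∈′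
    ... | _ , _ , refl | _ , _ , e = i≢i′ (cong proj₁ e)

  ord : Fin n → Fin n → Pair
  ord u v with u <? v
  ... | yes _ = (u , v)
  ... | no _ = (v , u)

  ord-cases : ∀ u v → ord u v ≡ (u , v) ⊎ ord u v ≡ (v , u)
  ord-cases u v with u <? v
  ... | yes _ = inj₁ refl
  ... | no _ = inj₂ refl

  ord-< : ∀ {u v} → u < v → ord u v ≡ (u , v)
  ord-< {u} {v} u<v with u <? v
  ... | yes _ = refl
  ... | no u≮v = ⊥-elim (u≮v u<v)

  ord-> : ∀ {u v} → u < v → ord v u ≡ (u , v)
  ord-> {u} {v} u<v with v <? u
  ... | yes v<u = ⊥-elim (<-asym u<v v<u)
  ... | no _ = refl

  ord-∈-Pairs : ∀ {u v} → u ≢ v → ord u v ∈ Pairs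
  ord-∈-Pairs {u} {v} u≢v with u <? v
  ... | yes u<v = Pairs-complete u<v
  ... | no u≮v with <-cmp u v
  ...   | tri< u<v _ _ = ⊥-elim (u≮v u<v)
  ...   | tri≈ _ u≡v _ = ⊥-elim (u≢v u≡v)
  ...   | tri> _ _ v<u = Pairs-complete v<u

  ord-adj : ∀ (b : Adj n) → (∀ u v → b u v ≡ b v u) →
            ∀ u v → b (proj₁ (ord u v)) (proj₂ (ord u v)) ≡ b u v
  ord-adj b b-sym u v with ord-cases u v
  ... | inj₁ e rewrite e = refl
  ... | inj₂ e rewrite e = b-sym v u

  ord-endpoints : ∀ {w u v} → w ∈ᵥ ord u v → w ≡ u ⊎ w ≡ v
  ord-endpoints {w} {u} {v} w∈ with ord-cases u v
  ... | inj₁ e rewrite e = w∈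
  ... | inj₂ e rewrite e with w∈
  ...   | inj₁ w≡v = inj₂ w≡v
  ...   | inj₂ w≡u = inj₁ w≡u

IF : Bool → Bool → Bool → Bool
IF cut join keep = if cut then false else if join then true else keep

IF-true : ∀ cut join keep → IF cut join keep ≡ true → cut ≡ false × (join ≡ true ⊎ keep ≡ true)
IF-true false true _ _ = refl , inj₁ refl
IF-true false false _ h = refl , inj₂ h

IF-cut : ∀ {cut} join keep → cut ≡ true → IF cut join keep ≡ false
IF-cut _ _ refl = refl

IF-old : ∀ {cut join} keep → cut ≡ false → join ≡ false → IF cut join keep ≡ keep
IF-old _ refl refl = refl

module Compression {n : ℕ} (G : SimpleGraph n) (x y : Fin n) where

  a a′ : Adj n
  a = adj G
  a′ = compressAdj a x y

  N : Fin n → Bool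
  N = inN a x y

  cut join : Fin n → Fin n → Bool
  cut u v = (N u ∧ (v == x)) ∨ (N v ∧ (u == x))
  join u v = (N u ∧ (v == y)) ∨ (N v ∧ (u == y))

  a-sym : ∀ u v → a u v ≡ a v u
  a-sym = adj-sym G

  a′-sym : ∀ u v → a′ u v ≡ a′ v u
  a′-sym u v = cong₃ IF (∨-comm (N u ∧ (v == x)) _) (∨-comm (N u ∧ (v == y)) _) (a-sym u v)
    where
    cong₃ : ∀ f {p p′ q q′ r r′} → p ≡ p′ → q ≡ q′ → r ≡ r′ → f p q r ≡ f p′ q′ r′
    cong₃ f refl refl refl = refl

  N-sound : ∀ {w} → N w ≡ true → w ≢ x × w ≢ y × a w x ≡ true × a w y ≡ false
  N-sound {w} h with ∧-true (not (w == x)) h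
  ... | w≢x , h′ with ∧-true (not (w == y)) h′
  ... | w≢y , h″ with ∧-true (a w x) h″
  ... | wx , wy = not-==⇒≢ w≢x , not-==⇒≢ w≢y , wx , not-true wy

  N-x : N x ≡ false
  N-x rewrite ==-refl x = refl

  N-false⇒adj-y : ∀ {z} → z ≢ x → z ≢ y → a z x ≡ true → N z ≡ false → a z y ≡ true
  N-false⇒adj-y {z} z≢x z≢y zx hN = not-false (trans (sym N-z) hN)
    where
    N-z : N z ≡ not (a z y)
    N-z rewrite ==-false z≢x | ==-false z≢y | zx = refl

  a′-far : ∀ {u v} → u ≢ x → u ≢ y → v ≢ x → v ≢ y → a′ u v ≡ a u v
  a′-far {u} {v} u≢x u≢y v≢x v≢y = IF-old (a u v)
    (cong₂ _∨_ (∧-≢ (N u) v≢x) (∧-≢ (N v) u≢x)) (cong₂ _∨_ (∧-≢ (N u) v≢y) (∧-≢ (N v) u≢y))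
    where
    ∧-≢ : ∀ b {s t} → s ≢ t → b ∧ (s == t) ≡ false
    ∧-≢ b s≢t = trans (cong (b ∧_) (==-false s≢t)) (∧-zeroʳ b)

  NewEdge : Fin n → Fin n → Set
  NewEdge u v = (N u ≡ true × v ≡ y) ⊎ (N v ≡ true × u ≡ y)

  a′-new : ∀ {u v} → a′ u v ≡ true → a u v ≡ false → NewEdge u v
  a′-new {u} {v} h uv∉G with IF-true (cut u v) (join u v) (a u v) h
  ... | _ , inj₂ uv∈G = ⊥-elim (true≢false (trans (sym uv∈G) uv∉G))
  ... | _ , inj₁ joined with ∨-true (N u ∧ (v == y)) joined
  ...   | inj₁ h′ = inj₁ (proj₁ (∧-true (N u) h′) , ==-true⇒≡ (proj₂ (∧-true (N u) h′)))
  ...   | inj₂ h′ = inj₂ (proj₁ (∧-true (N v) h′) , ==-true⇒≡ (proj₂ (∧-true (N v) h′)))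

  a′-deleted : ∀ {w} → N w ≡ true → a′ w x ≡ false
  a′-deleted {w} w∈N = IF-cut (join w x) (a w x)
    (cong (λ t → t ∨ (N x ∧ (w == x))) (cong₂ _∧_ w∈N (==-refl x)))

  a′-at-x : ∀ {z} → a′ x z ≡ true → a x z ≡ true × N z ≡ false
  a′-at-x {z} h with N z
  ... | true = ⊥-elim (true≢false (trans (sym h) (IF-cut ((N x ∧ (z == y)) ∨ (x == y)) (a x z) x-cut)))
    where
    x-cut : (N x ∧ (z == x)) ∨ (x == x) ≡ true
    x-cut = trans (cong ((N x ∧ (z == x)) ∨_) (==-refl x)) (∨-zeroʳ _)
  ... | false = trans (sym (IF-old _ (N-x-∧ (z == x)) (N-x-∧ (z == y)))) h , refl
    where
    N-x-∧ : ∀ b → (N x ∧ b) ∨ false ≡ false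
    N-x-∧ b = trans (∨-identityʳ _) (cong (_∧ b) N-x)

  σ : Fin n → Fin n
  σ v with v ≟ x | v ≟ y
  ... | yes _ | _ = y
  ... | no _ | yes _ = x
  ... | no _ | no _ = v

  σ-x : σ x ≡ y
  σ-x with x ≟ x
  ... | yes _ = refl
  ... | no x≢x = ⊥-elim (x≢x refl)

  σ-y : σ y ≡ x
  σ-y with y ≟ x | y ≟ y
  ... | yes y≡x | _ = y≡x
  ... | no _ | yes _ = refl
  ... | no _ | no y≢y = ⊥-elim (y≢y refl)

  σ-fix : ∀ {v} → v ≢ x → v ≢ y → σ v ≡ v
  σ-fix {v} v≢x v≢y with v ≟ x | v ≟ y
  ... | yes v≡x | _ = ⊥-elim (v≢x v≡x)
  ... | no _ | yes v≡y = ⊥-elim (v≢y v≡y)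
  ... | no _ | no _ = refl

  σ-involutive : ∀ v → σ (σ v) ≡ v
  σ-involutive v with toSum (v ≟ x) | toSum (v ≟ y)
  ... | inj₁ refl | _ = trans (cong σ σ-x) σ-y
  ... | inj₂ _ | inj₁ refl = trans (cong σ σ-y) σ-x
  ... | inj₂ v≢x | inj₂ v≢y = trans (cong σ (σ-fix v≢x v≢y)) (σ-fix v≢x v≢y)

  σ-injective : ∀ {u v} → σ u ≡ σ v → u ≡ v
  σ-injective {u} {v} e = trans (sym (σ-involutive u)) (trans (cong σ e) (σ-involutive v))

  σ-edge-at-x : ∀ {z} → z ≢ x → z ≢ y → a′ x z ≡ true → a y z ≡ true
  σ-edge-at-x {z} z≢x z≢y h with a′-at-x h
  ... | xz , z∉N = trans (a-sym y z) (N-false⇒adj-y z≢x z≢y (trans (a-sym z x) xz) z∉N)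

  σ-edge : ∀ {u v} → u ≢ v → u ≢ y → v ≢ y → a′ u v ≡ true → a (σ u) (σ v) ≡ true
  σ-edge {u} {v} u≢v u≢y v≢y h with toSum (u ≟ x) | toSum (v ≟ x)
  ... | inj₁ refl | _ =
    trans (cong₂ a σ-x (σ-fix v≢x v≢y)) (σ-edge-at-x v≢x v≢y h)
    where
    v≢x : v ≢ x
    v≢x v≡x = u≢v (sym v≡x)
  ... | inj₂ u≢x | inj₁ refl =
    trans (cong₂ a (σ-fix u≢x u≢y) σ-x) (trans (a-sym u y) (σ-edge-at-x u≢x u≢y (trans (a′-sym x u) h)))
  ... | inj₂ u≢x | inj₂ v≢x =
    trans (cong₂ a (σ-fix u≢x u≢y) (σ-fix v≢x v≢y)) (trans (sym (a′-far u≢x u≢y v≢x v≢y)) h)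

  NewEdge-y : ∀ {u v} → NewEdge u v → y ∈ᵥ (u , v)
  NewEdge-y (inj₁ (_ , refl)) = inj₂ refl
  NewEdge-y (inj₂ (_ , refl)) = inj₁ refl

  σ-new-edge-in-G : ∀ {u v} → NewEdge u v → a (σ u) (σ v) ≡ true
  σ-new-edge-in-G {u} (inj₁ (u∈N , refl)) with N-sound {u} u∈N
  ... | u≢x , u≢y , ux , _ = trans (cong₂ a (σ-fix u≢x u≢y) σ-y) ux
  σ-new-edge-in-G {v = v} (inj₂ (v∈N , refl)) with N-sound {v} v∈N
  ... | v≢x , v≢y , vx , _ = trans (cong₂ a σ-y (σ-fix v≢x v≢y)) (trans (a-sym x v) vx)

  σ-new-edge-not-in-G′ : ∀ {u v} → NewEdge u v → a′ (σ u) (σ v) ≡ false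
  σ-new-edge-not-in-G′ {u} (inj₁ (u∈N , refl)) with N-sound {u} u∈N
  ... | u≢x , u≢y , _ = trans (cong₂ a′ (σ-fix u≢x u≢y) σ-y) (a′-deleted {u} u∈N)
  σ-new-edge-not-in-G′ {v = v} (inj₂ (v∈N , refl)) with N-sound {v} v∈N
  ... | v≢x , v≢y , _ = trans (cong₂ a′ σ-y (σ-fix v≢x v≢y)) (trans (a′-sym x v) (a′-deleted {v} v∈N))

  τ : Pair → Pair
  τ p = ord (σ (proj₁ p)) (σ (proj₂ p))

  τ-Pairs : ∀ {p} → p ∈ Pairs → τ p ∈ Pairs
  τ-Pairs p∈ = ord-∈-Pairs (λ e → <⇒≢ (Pairs-ordered p∈) (σ-injective e))

  τ-involutive : ∀ {p} → p ∈ Pairs → τ (τ p) ≡ p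
  τ-involutive {i , j} p∈ with ord-cases (σ i) (σ j)
  ... | inj₁ e rewrite e | σ-involutive i | σ-involutive j = ord-< (Pairs-ordered p∈)
  ... | inj₂ e rewrite e | σ-involutive i | σ-involutive j = ord-> (Pairs-ordered p∈)

  τ-injective : ∀ {p q} → p ∈ Pairs → q ∈ Pairs → τ p ≡ τ q → p ≡ q
  τ-injective p∈ q∈ e = trans (sym (τ-involutive p∈)) (trans (cong τ e) (τ-involutive q∈))

  -- Since σ is injective, τ keeps apart pairs apart.
  τ-Apart : ∀ {p q} → Apart p q → Apart (τ p) (τ q)
  τ-Apart {i , j} {k , l} apart w∈τp w∈τq = shared (ord-endpoints w∈τp) (ord-endpoints w∈τq)
    where
    same : ∀ {w v v′} → w ≡ σ v → w ≡ σ v′ → v ≡ v′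
    same w≡σv w≡σv′ = σ-injective (trans (sym w≡σv) w≡σv′)
    shared : ∀ {w} → w ≡ σ i ⊎ w ≡ σ j → w ≡ σ k ⊎ w ≡ σ l → ⊥
    shared (inj₁ wi) (inj₁ wk) = apart (inj₁ refl) (inj₁ (same wi wk))
    shared (inj₁ wi) (inj₂ wl) = apart (inj₁ refl) (inj₂ (same wi wl))
    shared (inj₂ wj) (inj₁ wk) = apart (inj₂ refl) (inj₁ (same wj wk))
    shared (inj₂ wj) (inj₂ wl) = apart (inj₂ refl) (inj₂ (same wj wl))

  swap-Matching : ∀ {S p₀} → Matching a′ S → (∀ {q} → q ∈ S → q ∈ Pairs) → p₀ ∈ S →
                  a (proj₁ p₀) (proj₂ p₀) ≡ false → Matching a (map τ S)
  swap-Matching {S} {p₀} (edges , disjoint) S⊆Pairs p₀∈ p₀∉G = edges′ , disjoint′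
    where
    new : NewEdge (proj₁ p₀) (proj₂ p₀)
    new = a′-new (edges p₀∈) p₀∉G
    -- p₀ itself goes to an old edge; every other pair of S avoids y (it is apart from p₀).
    σ-edge-of : ∀ {p} → p ∈ S → a (σ (proj₁ p)) (σ (proj₂ p)) ≡ true
    σ-edge-of {p} p∈ with toSum (≡-dec _≟_ _≟_ p p₀)
    ... | inj₁ refl = σ-new-edge-in-G new
    ... | inj₂ p≢p₀ = σ-edge (<⇒≢ (Pairs-ordered (S⊆Pairs p∈)))
        (λ e → apart (inj₁ (sym e)) (NewEdge-y new))
        (λ e → apart (inj₂ (sym e)) (NewEdge-y new))
        (edges p∈)
      where
      apart : Apart p p₀
      apart = disjoint p∈ p₀∈ p≢p₀
    edges′ : ∀ {q} → q ∈ map τ S → IsEdge a q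
    edges′ q∈ with ∈-map⁻ τ q∈
    ... | p , p∈ , refl = trans (ord-adj a a-sym (σ (proj₁ p)) (σ (proj₂ p))) (σ-edge-of p∈)
    disjoint′ : ∀ {q q′} → q ∈ map τ S → q′ ∈ map τ S → q ≢ q′ → Apart q q′
    disjoint′ q∈ q′∈ q≢q′ with ∈-map⁻ τ q∈ | ∈-map⁻ τ q′∈
    ... | p , p∈ , refl | p′ , p′∈ , refl = τ-Apart (disjoint p∈ p′∈ (λ e → q≢q′ (cong τ e)))

  swap-not-in-G′ : ∀ {p₀} → IsEdge a′ p₀ → a (proj₁ p₀) (proj₂ p₀) ≡ false →
                   a′ (proj₁ (τ p₀)) (proj₂ (τ p₀)) ≡ false
  swap-not-in-G′ {i , j} p₀∈G′ p₀∉G =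
    trans (ord-adj a′ a′-sym (σ i) (σ j)) (σ-new-edge-not-in-G′ (a′-new p₀∈G′ p₀∉G))

module Injection {n : ℕ} (G : SimpleGraph n) (x y : Fin n) (k : ℕ) where
  open Compression G x y
  open import Data.List.Membership.DecPropositional (≡-dec (_≟_ {n}) (_≟_ {n})) using (_∈?_)

  kMatchings : Adj n → List (List Pair)
  kMatchings b = filter (λ S → isMatching b S ∧ (length S ≡ᵇ k) Data.Bool.≟ true) (subsets Pairs)

  record KMatching (b : Adj n) (S : List Pair) : Set where
    field
      subset   : S ∈ subsets Pairs
      matching : Matching b S
      size     : (length S ≡ᵇ k) ≡ true

    ⊆Pairs : ∀ {q} → q ∈ S → q ∈ Pairs
    ⊆Pairs = subsets-⊆ Pairs subset

    unique : Unique S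
    unique = subsets-member-unique Pairs Pairs-unique subset

  kMatching⁻ : ∀ {b S} → S ∈ kMatchings b → KMatching b S
  kMatching⁻ {b} {S} S∈ = record
    { subset = proj₁ S∈′
    ; matching = isMatching⇒Matching b S (proj₁ (∧-true (isMatching b S) (proj₂ S∈′)))
    ; size = proj₂ (∧-true (isMatching b S) (proj₂ S∈′))
    }
    where
    S∈′ = ∈-filter⁻ (λ S → isMatching b S ∧ (length S ≡ᵇ k) Data.Bool.≟ true) {xs = subsets Pairs} S∈

  kMatching⁺ : ∀ {b S} → KMatching b S → S ∈ kMatchings b
  kMatching⁺ {b} {S} M = ∈-filter⁺ (λ S → isMatching b S ∧ (length S ≡ᵇ k) Data.Bool.≟ true) subset
    (∧-intro (Matching⇒isMatching b S unique matching) size)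
    where open KMatching M

  edge : Pair → Bool
  edge p = a (proj₁ p) (proj₂ p)

  old : List Pair → Bool
  old S = allB edge S

  -- σ(S), re-listed in the order of Pairs so that it is again a member of subsets Pairs.
  swapped : List Pair → List Pair
  swapped S = filter (_∈? map τ S) Pairs

  swapped⁻ : ∀ {S q} → q ∈ swapped S → q ∈ Pairs × q ∈ map τ S
  swapped⁻ {S} = ∈-filter⁻ (_∈? map τ S) {xs = Pairs}

  swapped⁺ : ∀ {S q} → q ∈ Pairs → q ∈ map τ S → q ∈ swapped S
  swapped⁺ {S} = ∈-filter⁺ (_∈? map τ S)

  swapped-unique : ∀ S → Unique (swapped S)
  swapped-unique S = filter⁺ (_∈? map τ S) Pairs-unique

  τ-∈-swapped : ∀ {S p} → (∀ {q} → q ∈ S → q ∈ Pairs) → p ∈ S → τ p ∈ swapped S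
  τ-∈-swapped S⊆Pairs p∈ = swapped⁺ (τ-Pairs (S⊆Pairs p∈)) (∈-map⁺ τ p∈)

  τ-∈-swapped⁻ : ∀ {S q} → (∀ {p} → p ∈ S → p ∈ Pairs) → q ∈ swapped S → τ q ∈ S
  τ-∈-swapped⁻ S⊆Pairs q∈ with ∈-map⁻ τ (proj₂ (swapped⁻ q∈))
  ... | p , p∈ , refl = subst (_∈ _) (sym (τ-involutive (S⊆Pairs p∈))) p∈

  swapped-length : ∀ {S} → (∀ {q} → q ∈ S → q ∈ Pairs) → Unique S → length (swapped S) ≡ length S
  swapped-length {S} S⊆Pairs uS = ≤-antisym
    (length-≤-by-injection (swapped S) S τ (swapped-unique S) (τ-∈-swapped⁻ S⊆Pairs) τ-inj-swapped)
    (length-≤-by-injection S (swapped S) τ uS (τ-∈-swapped S⊆Pairs)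
      (λ p∈ q∈ → τ-injective (S⊆Pairs p∈) (S⊆Pairs q∈)))
    where
    τ-inj-swapped : ∀ {p q} → p ∈ swapped S → q ∈ swapped S → τ p ≡ τ q → p ≡ q
    τ-inj-swapped p∈ q∈ = τ-injective (proj₁ (swapped⁻ p∈)) (proj₁ (swapped⁻ q∈))

  swapped-KMatching : ∀ {S} → KMatching a′ S → old S ≡ false → KMatching a (swapped S)
  swapped-KMatching {S} M S-new with allB-false {f = edge} {S} S-new
  ... | p₀ , p₀∈ , p₀∉G = record
    { subset = filter-∈-subsets (_∈? map τ S) Pairs
    ; matching = Matching-⊆ (swap-Matching matching ⊆Pairs p₀∈ p₀∉G) (λ q∈ → proj₂ (swapped⁻ q∈))
    ; size = subst (λ l → (l ≡ᵇ k) ≡ true) (sym (swapped-length ⊆Pairs unique)) size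
    }
    where open KMatching M

  -- The two branches of F have disjoint images: the swap of a k-matching S′ of G′ with a
  -- non-edge p₀ of G contains τ p₀, which G′ lacks, so it is not a k-matching of G′.
  swapped-∉ : ∀ {S S′} → KMatching a′ S → KMatching a′ S′ → old S′ ≡ false → S ≢ swapped S′
  swapped-∉ {S} {S′} M M′ S′-new refl with allB-false {f = edge} {S′} S′-new
  ... | p₀ , p₀∈ , p₀∉G =
    true≢false (trans (sym (proj₁ (KMatching.matching M) (τ-∈-swapped (KMatching.⊆Pairs M′) p₀∈)))
                      (swap-not-in-G′ (proj₁ (KMatching.matching M′) p₀∈) p₀∉G))

  swapped-injective : ∀ {S S′} → KMatching a′ S → KMatching a′ S′ → swapped S ≡ swapped S′ → S ≡ S′
  swapped-injective M M′ e = subsets-ext Pairs Pairs-unique (KMatching.subset M) (KMatching.subset M′)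
    (transport M M′ e) (transport M′ M (sym e))
    where
    transport : ∀ {S S′} → KMatching a′ S → KMatching a′ S′ → swapped S ≡ swapped S′ →
                ∀ {p} → p ∈ S → p ∈ S′
    transport M M′ e p∈ = subst (_∈ _) (τ-involutive (KMatching.⊆Pairs M p∈))
      (τ-∈-swapped⁻ (KMatching.⊆Pairs M′) (subst (_ ∈_) e (τ-∈-swapped (KMatching.⊆Pairs M) p∈)))

  old-KMatching : ∀ {S} → KMatching a′ S → old S ≡ true → KMatching a S
  old-KMatching M S-old = record
    { subset = subset ; matching = (λ p∈ → allB-sound S-old p∈) , proj₂ matching ; size = size }
    where open KMatching M

  F : List Pair → List Pair
  F S = if old S then S else swapped S

  F-into : ∀ {S} → KMatching a′ S → KMatching a (F S)
  F-into {S} M with old S in S-old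
  ... | true = old-KMatching M S-old
  ... | false = swapped-KMatching M S-old

  F-injective : ∀ {S S′} → KMatching a′ S → KMatching a′ S′ → F S ≡ F S′ → S ≡ S′
  F-injective {S} {S′} M M′ e with old S in S-old | old S′ in S′-old
  ... | true | true = e
  ... | true | false = ⊥-elim (swapped-∉ M M′ S′-old e)
  ... | false | true = ⊥-elim (swapped-∉ M′ M S-old (sym e))
  ... | false | false = swapped-injective M M′ e

  kMatchings-≤ : length (kMatchings a′) ≤ length (kMatchings a)
  kMatchings-≤ = length-≤-by-injection (kMatchings a′) (kMatchings a) F
    (filter⁺ _ (subsets-unique Pairs Pairs-unique))
    (λ S∈ → kMatching⁺ (F-into (kMatching⁻ S∈)))
    (λ S∈ S′∈ → F-injective (kMatching⁻ S∈) (kMatching⁻ S′∈))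

lemma4p1 : ∀ (n : ℕ) (G : SimpleGraph n) (x y : Fin n) (k : ℕ) →
    mCompress k G x y ≤ m k G
lemma4p1 n G x y k = Injection.kMatchings-≤ G x y k
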